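{- For each closed term $P\in\mathcal{SP}_A$ there is a unique term $Q$ which is a $\sigma$-normal form for some $\sigma\in A^s$ and satisfies $\mathrm{EqMFEL}\vdash P=Q$.
   Context: $A$ is a countable set of atoms; $A^s$ is the set of finite strings over $A$ with no atom occurring more than once. $\mathcal{SP}_A$: closed terms generated by $P::=\mathsf T\mid\mathsf F\mid a\mid \neg P\mid P\mathbin{\wedge_\bullet}P\mid P\mathbin{\vee_\bullet}P$ ($a\in A$). $\sigma$-normal forms: for $\sigma=\epsilon$ they are $\mathsf T$ and $\mathsf F$; for $\sigma=a\rho$ ($a\in A$) they are the terms $(a\mathbin{\wedge_\bullet}P_1)\mathbin{\vee_\bullet}(\neg a\mathbin{\wedge_\bullet}P_2)$ with $P_1,P_2$ $\rho$-normal forms. $\mathrm{EqMFEL}$ consists of: $\mathsf F=\neg\mathsf T$; $x\mathbin{\vee_\bullet}y=\neg(\neg x\mathbin{\wedge_\bullet}\neg y)$; $\neg\neg x=x$; $(x\mathbin{\wedge_\bullet}y)\mathbin{\wedge_\bullet}z=x\mathbin{\wedge_\bullet}(y\mathbin{\wedge_\bullet}z)$; $\mathsf T\mathbin{\wedge_\bullet}x=x$; $x\mathbin{\wedge_\bullet}\mathsf T=x$; $x\mathbin{\wedge_\bullet}\mathsf F=\mathsf F\mathbin{\wedge_\bullet}x$; $\neg x\mathbin{\wedge_\bullet}\mathsf F=x\mathbin{\wedge_\bullet}\mathsf F$; $(x\mathbin{\wedge_\bullet}\mathsf F)\mathbin{\vee_\bullet}y=(x\mathbin{\vee_\bullet}\mathsf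 T)\mathbin{\wedge_\bullet}y$; $x\mathbin{\vee_\bullet}(y\mathbin{\wedge_\bullet}\mathsf F)=x\mathbin{\wedge_\bullet}(y\mathbin{\vee_\bullet}\mathsf T)$; $(x\mathbin{\vee_\bullet}y)\mathbin{\wedge_\bullet}z=(\neg x\mathbin{\wedge_\bullet}(y\mathbin{\wedge_\bullet}z))\mathbin{\vee_\bullet}(x\mathbin{\wedge_\bullet}z)$. $\vdash$ is derivability in equational logic. -}

module Defs where

open import Data.Nat using (ℕ)
open import Data.List using (List; []; _∷_)
open import Data.List.Relation.Unary.Unique.Propositional using (Unique)
open import Data.Product using (Σ; _×_)
open import Function.Definitions using (Injective)
open import Relation.Binary.PropositionalEquality using (_≡_)

Countable : Set → Set
Countable A = Σ (A → ℕ) λ f → Injective _≡_ _≡_ f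

module _ (A : Set) where

  infixr 6 _∧•_
  infixr 5 _∨•_

  data SP : Set where
    T F  : SP
    at   : A → SP
    ¬_   : SP → SP
    _∧•_ : SP → SP → SP
    _∨•_ : SP → SP → SP

  As : List A → Set
  As σ = Unique σ

  data NF : List A → SP → Set where
    nf-T : NF [] T
    nf-F : NF [] F
    nf-a : ∀ {a ρ P₁ P₂} → NF ρ P₁ → NF ρ P₂ →
           NF (a ∷ ρ) ((at a ∧• P₁) ∨• ((¬ at a) ∧• P₂))

  -- derivability in equational logic from EqMFEL, for closed terms
  -- (axioms instantiated by arbitrary closed terms)
  infix 4 _⊢≈_
  data _⊢≈_ : SP → SP → Set where
    refl′ : ∀ {x} → x ⊢≈ x
    sym′  : ∀ {x y} → x ⊢≈ y → y ⊢≈ x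
    trans′ : ∀ {x y z} → x ⊢≈ y → y ⊢≈ z → x ⊢≈ z
    cong¬ : ∀ {x x′} → x ⊢≈ x′ → (¬ x) ⊢≈ (¬ x′)
    cong∧ : ∀ {x x′ y y′} → x ⊢≈ x′ → y ⊢≈ y′ → (x ∧• y) ⊢≈ (x′ ∧• y′)
    cong∨ : ∀ {x x′ y y′} → x ⊢≈ x′ → y ⊢≈ y′ → (x ∨• y) ⊢≈ (x′ ∨• y′)
    ax1  : F ⊢≈ ¬ T
    ax2  : ∀ x y → (x ∨• y) ⊢≈ ¬ ((¬ x) ∧• (¬ y))
    ax3  : ∀ x → (¬ (¬ x)) ⊢≈ x
    ax4  : ∀ x y z → ((x ∧• y) ∧• z) ⊢≈ (x ∧• (y ∧• z))
    ax5  : ∀ x → (T ∧• x) ⊢≈ x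
    ax6  : ∀ x → (x ∧• T) ⊢≈ x
    ax7  : ∀ x → (x ∧• F) ⊢≈ (F ∧• x)
    ax8  : ∀ x → ((¬ x) ∧• F) ⊢≈ (x ∧• F)
    ax9  : ∀ x y → ((x ∧• F) ∨• y) ⊢≈ ((x ∨• T) ∧• y)
    ax10 : ∀ x y → (x ∨• (y ∧• F)) ⊢≈ (x ∧• (y ∨• T))
    ax11 : ∀ x y z → ((x ∨• y) ∧• z) ⊢≈ (((¬ x) ∧• (y ∧• z)) ∨• (x ∧• z))

module Submission where

-- In MFEL, ∧• and ∨• evaluate left to right and the atoms of a term keep their
-- order of first occurrence, so ax1–ax11 preserve the list of atoms in that order
-- as well as the two-valued truth table.  A σ-normal form has σ as this list and
-- is determined by its truth table (split on the head of σ), which gives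
-- uniqueness.  For existence, let a be the first atom of P.  Then P ≈ a ⁺ ∧• P,
-- which unfolds to (a ∧• P) ∨• (¬ a ∧• P); after a has been evaluated, a may be
-- replaced by T resp. F throughout P, which lowers the number of atom
-- occurrences.  The two recursively obtained normal forms share σ because both
-- substitution instances of P have the same atoms.

open import Data.Bool using (Bool; true; false; not; _∧_; _∨_; if_then_else_)
open import Data.Bool.Properties using (∨-identityʳ; ∨-zeroʳ; ∧-assoc; ∧-identityʳ; ∧-zeroʳ; not-involutive)
open import Data.Empty using (⊥-elim)
open import Data.List using (List; []; _∷_; [_]; _++_; foldl)
open import Data.List.Properties using (foldl-++; ++-assoc; ++-identityʳ)
open import Data.List.Membership.Propositional using (_∈_; _∉_)
open import Data.List.Membership.Propositional.Properties using (∈-++⁺ˡ; ∈-++⁺ʳ; ∈-++⁻)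
open import Data.List.Relation.Unary.All as All using (All; []; _∷_)
open import Data.List.Relation.Unary.All.Properties using (¬Any⇒All¬)
open import Data.List.Relation.Unary.AllPairs using ([]; _∷_)
open import Data.List.Relation.Unary.Any using (here; there)
open import Data.List.Relation.Unary.Unique.Propositional using (Unique)
open import Data.Maybe using (Maybe; just; nothing; _<∣>_)
open import Data.Nat using (ℕ; _+_; _≤_; _<_; z≤n; s≤s)
open import Data.Nat.Induction using (<-wellFounded)
open import Data.Nat.Properties using (≤-refl; +-mono-≤; +-mono-<-≤; +-mono-≤-<; eq?)
open import Data.Product using (Σ; Σ-syntax; _×_; _,_; ∃!)
open import Data.Sum as Sum using (_⊎_; inj₁; inj₂)
open import Function.Base using (_∘_; id)
open import Function.Bundles using (mk↣)
open import Induction.WellFounded using (Acc; acc)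
open import Relation.Binary.Bundles using (Setoid)
open import Relation.Binary.Definitions using (DecidableEquality)
open import Relation.Binary.PropositionalEquality using (_≡_; _≢_; refl; sym; trans; cong; cong₂; subst; module ≡-Reasoning)
open import Relation.Nullary using (yes; no; does)
import Relation.Binary.Reasoning.Setoid as SetoidReasoning

open import Defs

module _ {A : Set} where

  infix 4 _≈_
  _≈_ : SP A → SP A → Set
  _≈_ = _⊢≈_ A

  ≈-setoid : Setoid _ _
  ≈-setoid = record
    { Carrier       = SP A
    ; _≈_           = _≈_
    ; isEquivalence = record { refl = refl′ ; sym = sym′ ; trans = trans′ }
    }

  open SetoidReasoning ≈-setoid

  _⁺ _⁻ : SP A → SP A
  x ⁺ = x ∨• T
  x ⁻ = x ∧• F

  ¬F≈T : ¬ F ≈ T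
  ¬F≈T = trans′ (cong¬ ax1) (ax3 T)

  deMorgan-∨• : ∀ x y → ¬ (x ∨• y) ≈ ¬ x ∧• ¬ y
  deMorgan-∨• x y = trans′ (cong¬ (ax2 x y)) (ax3 _)

  deMorgan-∧• : ∀ x y → ¬ (x ∧• y) ≈ ¬ x ∨• ¬ y
  deMorgan-∧• x y = sym′ (trans′ (ax2 (¬ x) (¬ y)) (cong¬ (cong∧ (ax3 x) (ax3 y))))

  ∨•-assoc : ∀ x y z → (x ∨• y) ∨• z ≈ x ∨• (y ∨• z)
  ∨•-assoc x y z = begin
    (x ∨• y) ∨• z           ≈⟨ ax2 _ _ ⟩
    ¬ (¬ (x ∨• y) ∧• ¬ z)   ≈⟨ cong¬ (cong∧ (deMorgan-∨• x y) refl′) ⟩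
    ¬ ((¬ x ∧• ¬ y) ∧• ¬ z) ≈⟨ cong¬ (ax4 _ _ _) ⟩
    ¬ (¬ x ∧• (¬ y ∧• ¬ z)) ≈⟨ cong¬ (cong∧ refl′ (deMorgan-∨• y z)) ⟨
    ¬ (¬ x ∧• ¬ (y ∨• z))   ≈⟨ ax2 _ _ ⟨
    x ∨• (y ∨• z)           ∎

  ∨•-identityʳ : ∀ x → x ∨• F ≈ x
  ∨•-identityʳ x = begin
    x ∨• F           ≈⟨ ax2 _ _ ⟩
    ¬ (¬ x ∧• ¬ F)   ≈⟨ cong¬ (cong∧ refl′ ¬F≈T) ⟩
    ¬ (¬ x ∧• T)     ≈⟨ cong¬ (ax6 _) ⟩
    ¬ ¬ x            ≈⟨ ax3 x ⟩
    x                ∎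

  ∨•-swap : ∀ x y → x ∨• y ≈ (¬ x ∧• y) ∨• x
  ∨•-swap x y = begin
    x ∨• y                        ≈⟨ ax6 _ ⟨
    (x ∨• y) ∧• T                 ≈⟨ ax11 x y T ⟩
    (¬ x ∧• (y ∧• T)) ∨• (x ∧• T) ≈⟨ cong∨ (cong∧ refl′ (ax6 y)) (ax6 x) ⟩
    (¬ x ∧• y) ∨• x               ∎

  ∧•-swap : ∀ x y → x ∧• y ≈ (¬ x ∨• y) ∧• x
  ∧•-swap x y = begin
    x ∧• y                    ≈⟨ ax3 _ ⟨
    ¬ ¬ (x ∧• y)              ≈⟨ cong¬ (deMorgan-∧• x y) ⟩
    ¬ (¬ x ∨• ¬ y)            ≈⟨ cong¬ (∨•-swap _ _) ⟩
    ¬ ((¬ ¬ x ∧• ¬ y) ∨• ¬ x) ≈⟨ deMorgan-∨• _ _ ⟩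
    ¬ (¬ ¬ x ∧• ¬ y) ∧• ¬ ¬ x ≈⟨ cong∧ (deMorgan-∧• _ _) (ax3 x) ⟩
    (¬ ¬ ¬ x ∨• ¬ ¬ y) ∧• x   ≈⟨ cong∧ (cong∨ (ax3 (¬ x)) (ax3 y)) refl′ ⟩
    (¬ x ∨• y) ∧• x           ∎

  ⁺≈¬⁻ : ∀ x → x ⁺ ≈ ¬ (x ⁻)
  ⁺≈¬⁻ x = begin
    x ∨• T         ≈⟨ ax2 _ _ ⟩
    ¬ (¬ x ∧• ¬ T) ≈⟨ cong¬ (cong∧ refl′ ax1) ⟨
    ¬ (¬ x ∧• F)   ≈⟨ cong¬ (ax8 x) ⟩
    ¬ (x ∧• F)     ∎

  ⁺-¬ : ∀ x → (¬ x) ⁺ ≈ x ⁺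
  ⁺-¬ x = trans′ (⁺≈¬⁻ (¬ x)) (trans′ (cong¬ (ax8 x)) (sym′ (⁺≈¬⁻ x)))

  ⁺-∧• : ∀ x y → x ⁺ ∧• y ≈ (¬ x ∧• y) ∨• (x ∧• y)
  ⁺-∧• x y = trans′ (ax11 x T y) (cong∨ (cong∧ refl′ (ax5 y)) refl′)

  ⁺≈¬x∨x : ∀ x → x ⁺ ≈ ¬ x ∨• x
  ⁺≈¬x∨x x = trans′ (sym′ (ax6 _)) (trans′ (⁺-∧• x T) (cong∨ (ax6 _) (ax6 _)))

  -- P starts by evaluating u: u ⁺ evaluates u and then yields T whatever the outcome.
  Leads : SP A → SP A → Set
  Leads u P = u ⁺ ∧• P ≈ P

  Leads-refl : ∀ x → Leads x x
  Leads-refl x = begin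
    x ⁺ ∧• x        ≈⟨ ax9 x x ⟨
    (x ∧• F) ∨• x   ≈⟨ cong∨ (ax8 x) refl′ ⟨
    (¬ x ∧• F) ∨• x ≈⟨ ∨•-swap x F ⟨
    x ∨• F          ≈⟨ ∨•-identityʳ x ⟩
    x               ∎

  ∧•-idem : ∀ x → x ∧• x ≈ x
  ∧•-idem x = begin
    x ∧• x          ≈⟨ ∧•-swap x x ⟩
    (¬ x ∨• x) ∧• x ≈⟨ cong∧ (⁺≈¬x∨x x) refl′ ⟨
    x ⁺ ∧• x        ≈⟨ Leads-refl x ⟩
    x               ∎

  ∨•-idem : ∀ x → x ∨• x ≈ x
  ∨•-idem x = trans′ (ax2 x x) (trans′ (cong¬ (∧•-idem _)) (ax3 x))

  ¬x∧x≈x⁻ : ∀ x → ¬ x ∧• x ≈ x ⁻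
  ¬x∧x≈x⁻ x = sym′ (trans′ (∧•-swap x F) (cong∧ (∨•-identityʳ _) refl′))

  x∧[¬x∨y]≈x∧y : ∀ x y → x ∧• (¬ x ∨• y) ≈ x ∧• y
  x∧[¬x∨y]≈x∧y x y = begin
    x ∧• (¬ x ∨• y)          ≈⟨ ∧•-swap _ _ ⟩
    (¬ x ∨• (¬ x ∨• y)) ∧• x ≈⟨ cong∧ (∨•-assoc _ _ _) refl′ ⟨
    ((¬ x ∨• ¬ x) ∨• y) ∧• x ≈⟨ cong∧ (cong∨ (∨•-idem _) refl′) refl′ ⟩
    (¬ x ∨• y) ∧• x          ≈⟨ ∧•-swap _ _ ⟨
    x ∧• y                   ∎

  x∧¬y≈x∧¬[x∧y] : ∀ x y → x ∧• ¬ y ≈ x ∧• ¬ (x ∧• y)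
  x∧¬y≈x∧¬[x∧y] x y =
    sym′ (trans′ (cong∧ refl′ (deMorgan-∧• x y)) (x∧[¬x∨y]≈x∧y x (¬ y)))

  -- Equality under the assumption that u has just been evaluated to T.
  infix 4 _≈[_]_
  _≈[_]_ : SP A → SP A → SP A → Set
  P ≈[ u ] P′ = u ∧• P ≈ u ∧• P′

  x≈[x]T : ∀ x → x ≈[ x ] T
  x≈[x]T x = trans′ (∧•-idem x) (sym′ (ax6 x))

  x≈[¬x]F : ∀ x → x ≈[ ¬ x ] F
  x≈[¬x]F x = trans′ (¬x∧x≈x⁻ x) (sym′ (ax8 x))

  ≈[]-cong¬ : ∀ {u P P′} → P ≈[ u ] P′ → ¬ P ≈[ u ] ¬ P′
  ≈[]-cong¬ {u} {P} {P′} h = begin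
    u ∧• ¬ P          ≈⟨ x∧¬y≈x∧¬[x∧y] u P ⟩
    u ∧• ¬ (u ∧• P)   ≈⟨ cong∧ refl′ (cong¬ h) ⟩
    u ∧• ¬ (u ∧• P′)  ≈⟨ x∧¬y≈x∧¬[x∧y] u P′ ⟨
    u ∧• ¬ P′         ∎

  -- ∧•-swap moves the guard u past P so that it also guards Q.
  ≈[]-cong∧ : ∀ {u P P′ Q Q′} → P ≈[ u ] P′ → Q ≈[ u ] Q′ → P ∧• Q ≈[ u ] P′ ∧• Q′
  ≈[]-cong∧ {u} {P} {P′} {Q} {Q′} h₁ h₂ = begin
    u ∧• (P ∧• Q)            ≈⟨ ax4 _ _ _ ⟨
    (u ∧• P) ∧• Q            ≈⟨ cong∧ (trans′ h₁ (∧•-swap _ _)) refl′ ⟩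
    ((¬ u ∨• P′) ∧• u) ∧• Q  ≈⟨ ax4 _ _ _ ⟩
    (¬ u ∨• P′) ∧• (u ∧• Q)  ≈⟨ cong∧ refl′ h₂ ⟩
    (¬ u ∨• P′) ∧• (u ∧• Q′) ≈⟨ ax4 _ _ _ ⟨
    ((¬ u ∨• P′) ∧• u) ∧• Q′ ≈⟨ cong∧ (∧•-swap _ _) refl′ ⟨
    (u ∧• P′) ∧• Q′          ≈⟨ ax4 _ _ _ ⟩
    u ∧• (P′ ∧• Q′)          ∎

  ≈[]-cong∨ : ∀ {u P P′ Q Q′} → P ≈[ u ] P′ → Q ≈[ u ] Q′ → P ∨• Q ≈[ u ] P′ ∨• Q′
  ≈[]-cong∨ {u} {P} {P′} {Q} {Q′} h₁ h₂ = begin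
    u ∧• (P ∨• Q)          ≈⟨ cong∧ refl′ (ax2 _ _) ⟩
    u ∧• ¬ (¬ P ∧• ¬ Q)    ≈⟨ ≈[]-cong¬ (≈[]-cong∧ (≈[]-cong¬ h₁) (≈[]-cong¬ h₂)) ⟩
    u ∧• ¬ (¬ P′ ∧• ¬ Q′)  ≈⟨ cong∧ refl′ (ax2 _ _) ⟨
    u ∧• (P′ ∨• Q′)        ∎

  IsConst : SP A → Set
  IsConst x = x ≈ T ⊎ x ≈ F

  IsConst-¬ : ∀ {x} → IsConst x → IsConst (¬ x)
  IsConst-¬ (inj₁ x≈T) = inj₂ (trans′ (cong¬ x≈T) (sym′ ax1))
  IsConst-¬ (inj₂ x≈F) = inj₁ (trans′ (cong¬ x≈F) ¬F≈T)

  IsConst-∧ : ∀ {x y} → IsConst x → IsConst y → IsConst (x ∧• y)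
  IsConst-∧ (inj₁ x≈T) (inj₁ y≈T) = inj₁ (trans′ (cong∧ x≈T y≈T) (ax5 T))
  IsConst-∧ (inj₁ x≈T) (inj₂ y≈F) = inj₂ (trans′ (cong∧ x≈T y≈F) (ax5 F))
  IsConst-∧ (inj₂ x≈F) (inj₁ y≈T) = inj₂ (trans′ (cong∧ x≈F y≈T) (ax6 F))
  IsConst-∧ (inj₂ x≈F) (inj₂ y≈F) = inj₂ (trans′ (cong∧ x≈F y≈F) (∧•-idem F))

  IsConst-∨ : ∀ {x y} → IsConst x → IsConst y → IsConst (x ∨• y)
  IsConst-∨ p q =
    Sum.map (trans′ (ax2 _ _)) (trans′ (ax2 _ _)) (IsConst-¬ (IsConst-∧ (IsConst-¬ p) (IsConst-¬ q)))

  Leads-resp : ∀ {u P P′} → P ≈ P′ → Leads u P → Leads u P′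
  Leads-resp P≈P′ h = trans′ (cong∧ refl′ (sym′ P≈P′)) (trans′ h P≈P′)

  -- By ax9, u ⁺ ∧• _ is u ⁻ ∨• _, and the latter commutes with ¬ by de Morgan.
  Leads-¬ : ∀ {u P} → Leads u P → Leads u (¬ P)
  Leads-¬ {u} {P} h = begin
    u ⁺ ∧• ¬ P            ≈⟨ ax9 u (¬ P) ⟨
    u ⁻ ∨• ¬ P            ≈⟨ ax2 _ _ ⟩
    ¬ (¬ (u ⁻) ∧• ¬ ¬ P)  ≈⟨ cong¬ (cong∧ (sym′ (⁺≈¬⁻ u)) (ax3 P)) ⟩
    ¬ (u ⁺ ∧• P)          ≈⟨ cong¬ h ⟩
    ¬ P                   ∎

  Leads-∧ˡ : ∀ {u P} Q → Leads u P → Leads u (P ∧• Q)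
  Leads-∧ˡ Q h = trans′ (sym′ (ax4 _ _ _)) (cong∧ h refl′)

  Leads-∧ʳ : ∀ {u P Q} → IsConst P → Leads u Q → Leads u (P ∧• Q)
  Leads-∧ʳ {Q = Q} (inj₁ P≈T) h = Leads-resp (trans′ (sym′ (ax5 Q)) (cong∧ (sym′ P≈T) refl′)) h
  Leads-∧ʳ {Q = Q} (inj₂ P≈F) h = Leads-resp (trans′ (ax7 Q) (cong∧ (sym′ P≈F) refl′)) (Leads-∧ˡ F h)

  Leads-∨ˡ : ∀ {u P} Q → Leads u P → Leads u (P ∨• Q)
  Leads-∨ˡ Q h = Leads-resp (sym′ (ax2 _ _)) (Leads-¬ (Leads-∧ˡ _ (Leads-¬ h)))

  Leads-∨ʳ : ∀ {u P Q} → IsConst P → Leads u Q → Leads u (P ∨• Q)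
  Leads-∨ʳ c h = Leads-resp (sym′ (ax2 _ _)) (Leads-¬ (Leads-∧ʳ (IsConst-¬ c) (Leads-¬ h)))

  Leads-expand : ∀ {u P} → Leads u P → P ≈ (u ∧• P) ∨• (¬ u ∧• P)
  Leads-expand {u} {P} h = begin
    P                          ≈⟨ h ⟨
    u ⁺ ∧• P                   ≈⟨ cong∧ (⁺-¬ u) refl′ ⟨
    (¬ u) ⁺ ∧• P               ≈⟨ ⁺-∧• (¬ u) P ⟩
    (¬ ¬ u ∧• P) ∨• (¬ u ∧• P) ≈⟨ cong∨ (cong∧ (ax3 u) refl′) refl′ ⟩
    (u ∧• P) ∨• (¬ u ∧• P)     ∎

  infix 5 _◁_▷_
  _◁_▷_ : SP A → A → SP A → SP A
  P ◁ a ▷ Q = (at a ∧• P) ∨• (¬ at a ∧• Q)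

  ⟦_⟧ : SP A → (A → Bool) → Bool
  ⟦ T ⟧      v = true
  ⟦ F ⟧      v = false
  ⟦ at a ⟧   v = v a
  ⟦ ¬ x ⟧    v = not (⟦ x ⟧ v)
  ⟦ x ∧• y ⟧ v = ⟦ x ⟧ v ∧ ⟦ y ⟧ v
  ⟦ x ∨• y ⟧ v = ⟦ x ⟧ v ∨ ⟦ y ⟧ v

  ⟦⟧-sound : ∀ {P Q} → P ≈ Q → ∀ v → ⟦ P ⟧ v ≡ ⟦ Q ⟧ v
  ⟦⟧-sound refl′          v = refl
  ⟦⟧-sound (sym′ p)       v = sym (⟦⟧-sound p v)
  ⟦⟧-sound (trans′ p q)   v = trans (⟦⟧-sound p v) (⟦⟧-sound q v)
  ⟦⟧-sound (cong¬ p)      v = cong not (⟦⟧-sound p v)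
  ⟦⟧-sound (cong∧ p q)    v = cong₂ _∧_ (⟦⟧-sound p v) (⟦⟧-sound q v)
  ⟦⟧-sound (cong∨ p q)    v = cong₂ _∨_ (⟦⟧-sound p v) (⟦⟧-sound q v)
  ⟦⟧-sound ax1            v = refl
  ⟦⟧-sound (ax2 x y)      v = ax2ᵇ (⟦ x ⟧ v) (⟦ y ⟧ v)
    where
    ax2ᵇ : ∀ x y → x ∨ y ≡ not (not x ∧ not y)
    ax2ᵇ true  y = refl
    ax2ᵇ false y = sym (not-involutive y)
  ⟦⟧-sound (ax3 x)        v = not-involutive (⟦ x ⟧ v)
  ⟦⟧-sound (ax4 x y z)    v = ∧-assoc (⟦ x ⟧ v) (⟦ y ⟧ v) (⟦ z ⟧ v)
  ⟦⟧-sound (ax5 x)        v = refl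
  ⟦⟧-sound (ax6 x)        v = ∧-identityʳ (⟦ x ⟧ v)
  ⟦⟧-sound (ax7 x)        v = ∧-zeroʳ (⟦ x ⟧ v)
  ⟦⟧-sound (ax8 x)        v = trans (∧-zeroʳ _) (sym (∧-zeroʳ (⟦ x ⟧ v)))
  ⟦⟧-sound (ax9 x y)      v = ax9ᵇ (⟦ x ⟧ v) (⟦ y ⟧ v)
    where
    ax9ᵇ : ∀ x y → (x ∧ false) ∨ y ≡ (x ∨ true) ∧ y
    ax9ᵇ true  y = refl
    ax9ᵇ false y = refl
  ⟦⟧-sound (ax10 x y)     v = ax10ᵇ (⟦ x ⟧ v) (⟦ y ⟧ v)
    where
    ax10ᵇ : ∀ x y → x ∨ (y ∧ false) ≡ x ∧ (y ∨ true)
    ax10ᵇ true  y = sym (∨-zeroʳ y)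
    ax10ᵇ false y = ∧-zeroʳ y
  ⟦⟧-sound (ax11 x y z)   v = ax11ᵇ (⟦ x ⟧ v) (⟦ y ⟧ v) (⟦ z ⟧ v)
    where
    ax11ᵇ : ∀ x y z → (x ∨ y) ∧ z ≡ (not x ∧ (y ∧ z)) ∨ (x ∧ z)
    ax11ᵇ true  y z = refl
    ax11ᵇ false y z = sym (∨-identityʳ (y ∧ z))

  ⟦◁▷⟧ : ∀ v P a Q → ⟦ P ◁ a ▷ Q ⟧ v ≡ (if v a then ⟦ P ⟧ v else ⟦ Q ⟧ v)
  ⟦◁▷⟧ v P a Q with v a
  ... | true  = ∨-identityʳ (⟦ P ⟧ v)
  ... | false = refl

  ⟦⟧-NF-cong : ∀ {σ Q v w} → NF A σ Q → All (λ a → v a ≡ w a) σ → ⟦ Q ⟧ v ≡ ⟦ Q ⟧ w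
  ⟦⟧-NF-cong nf-T           _             = refl
  ⟦⟧-NF-cong nf-F           _             = refl
  ⟦⟧-NF-cong (nf-a nfP nfQ) (va≡wa ∷ v≗w) =
    cong₂ _∨_ (cong₂ _∧_ va≡wa (⟦⟧-NF-cong nfP v≗w))
              (cong₂ _∧_ (cong not va≡wa) (⟦⟧-NF-cong nfQ v≗w))

module _ {A : Set} (_≟_ : DecidableEquality A) where

  open import Data.List.Membership.DecPropositional _≟_ using (_∈?_)

  insertNew : List A → A → List A
  insertNew xs a with a ∈? xs
  ... | yes _ = xs
  ... | no  _ = xs ++ [ a ]

  insertNew-∈ : ∀ {a xs} → a ∈ xs → insertNew xs a ≡ xs
  insertNew-∈ {a} {xs} a∈xs with a ∈? xs
  ... | yes _   = refl
  ... | no a∉xs = ⊥-elim (a∉xs a∈xs)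

  insertNew-∉ : ∀ {a xs} → a ∉ xs → insertNew xs a ≡ xs ++ [ a ]
  insertNew-∉ {a} {xs} a∉xs with a ∈? xs
  ... | yes a∈xs = ⊥-elim (a∉xs a∈xs)
  ... | no  _    = refl

  ∈-insertNew⁺ˡ : ∀ {a b xs} → b ∈ xs → b ∈ insertNew xs a
  ∈-insertNew⁺ˡ {a} {xs = xs} b∈xs with a ∈? xs
  ... | yes _ = b∈xs
  ... | no  _ = ∈-++⁺ˡ b∈xs

  ∈-insertNew⁺ʳ : ∀ a xs → a ∈ insertNew xs a
  ∈-insertNew⁺ʳ a xs with a ∈? xs
  ... | yes a∈xs = a∈xs
  ... | no  _    = ∈-++⁺ʳ xs (here refl)

  ∈-insertNew⁻ : ∀ {a b xs} → b ∈ insertNew xs a → b ∈ xs ⊎ b ≡ a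
  ∈-insertNew⁻ {a} {xs = xs} b∈ with a ∈? xs
  ... | yes _ = inj₁ b∈
  ... | no  _ = Sum.map₂ ∈-singleton (∈-++⁻ xs b∈)
    where
    ∈-singleton : ∀ {b} → b ∈ [ a ] → b ≡ a
    ∈-singleton (here b≡a) = b≡a

  infixl 5 _⊕_
  _⊕_ : List A → List A → List A
  _⊕_ = foldl insertNew

  ∈-⊕⁺ˡ : ∀ {b} xs ys → b ∈ xs → b ∈ xs ⊕ ys
  ∈-⊕⁺ˡ xs []       b∈xs = b∈xs
  ∈-⊕⁺ˡ xs (y ∷ ys) b∈xs = ∈-⊕⁺ˡ (insertNew xs y) ys (∈-insertNew⁺ˡ b∈xs)

  ∈-⊕⁺ʳ : ∀ {b} xs ys → b ∈ ys → b ∈ xs ⊕ ys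
  ∈-⊕⁺ʳ xs (y ∷ ys) (here refl) = ∈-⊕⁺ˡ (insertNew xs y) ys (∈-insertNew⁺ʳ y xs)
  ∈-⊕⁺ʳ xs (y ∷ ys) (there b∈ys) = ∈-⊕⁺ʳ (insertNew xs y) ys b∈ys

  ∈-⊕⁻ : ∀ {b} xs ys → b ∈ xs ⊕ ys → b ∈ xs ⊎ b ∈ ys
  ∈-⊕⁻ xs []       b∈ = inj₁ b∈
  ∈-⊕⁻ xs (y ∷ ys) b∈ with ∈-⊕⁻ (insertNew xs y) ys b∈
  ... | inj₂ b∈ys = inj₂ (there b∈ys)
  ... | inj₁ b∈xs′ = Sum.map₂ here (∈-insertNew⁻ {xs = xs} b∈xs′)

  ⊕-absorb : ∀ xs ys → (∀ {b} → b ∈ ys → b ∈ xs) → xs ⊕ ys ≡ xs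
  ⊕-absorb xs []       _    = refl
  ⊕-absorb xs (y ∷ ys) ys⊆xs = begin
    insertNew xs y ⊕ ys ≡⟨ cong (_⊕ ys) (insertNew-∈ (ys⊆xs (here refl))) ⟩
    xs ⊕ ys             ≡⟨ ⊕-absorb xs ys (ys⊆xs ∘ there) ⟩
    xs                  ∎
    where open ≡-Reasoning

  ⊕-fresh : ∀ xs ys → Unique ys → (∀ {b} → b ∈ ys → b ∉ xs) → xs ⊕ ys ≡ xs ++ ys
  ⊕-fresh xs []       _            _     = sym (++-identityʳ xs)
  ⊕-fresh xs (y ∷ ys) (y∉ys ∷ !ys) fresh = begin
    insertNew xs y ⊕ ys ≡⟨ cong (_⊕ ys) (insertNew-∉ (fresh (here refl))) ⟩
    (xs ++ [ y ]) ⊕ ys ≡⟨ ⊕-fresh (xs ++ [ y ]) ys !ys fresh′ ⟩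
    (xs ++ [ y ]) ++ ys ≡⟨ ++-assoc xs [ y ] ys ⟩
    xs ++ y ∷ ys        ∎
    where
    open ≡-Reasoning
    fresh′ : ∀ {b} → b ∈ ys → b ∉ xs ++ [ y ]
    fresh′ b∈ys b∈ with ∈-++⁻ xs b∈
    ... | inj₁ b∈xs       = fresh (there b∈ys) b∈xs
    ... | inj₂ (here b≡y) = All.lookup y∉ys b∈ys (sym b≡y)

  ⊕-insertNew : ∀ xs ys z → xs ⊕ insertNew ys z ≡ insertNew (xs ⊕ ys) z
  ⊕-insertNew xs ys z with z ∈? ys
  ... | yes z∈ys = sym (insertNew-∈ (∈-⊕⁺ʳ xs ys z∈ys))
  ... | no  _    = foldl-++ insertNew xs ys [ z ]

  ⊕-assoc : ∀ xs ys zs → (xs ⊕ ys) ⊕ zs ≡ xs ⊕ (ys ⊕ zs)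
  ⊕-assoc xs ys []       = refl
  ⊕-assoc xs ys (z ∷ zs) =
    trans (cong (_⊕ zs) (sym (⊕-insertNew xs ys z))) (⊕-assoc xs (insertNew ys z) zs)

  atoms : SP A → List A
  atoms T        = []
  atoms F        = []
  atoms (at a)   = [ a ]
  atoms (¬ x)    = atoms x
  atoms (x ∧• y) = atoms x ⊕ atoms y
  atoms (x ∨• y) = atoms x ⊕ atoms y

  []⊕atoms : ∀ x → [] ⊕ atoms x ≡ atoms x
  []⊕atoms T        = refl
  []⊕atoms F        = refl
  []⊕atoms (at a)   = insertNew-∉ {a} {[]} λ ()
  []⊕atoms (¬ x)    = []⊕atoms x
  []⊕atoms (x ∧• y) = trans (sym (⊕-assoc [] (atoms x) (atoms y))) (cong (_⊕ atoms y) ([]⊕atoms x))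
  []⊕atoms (x ∨• y) = trans (sym (⊕-assoc [] (atoms x) (atoms y))) (cong (_⊕ atoms y) ([]⊕atoms x))

  atoms-sound : ∀ {P Q} → P ≈ Q → atoms P ≡ atoms Q
  atoms-sound refl′         = refl
  atoms-sound (sym′ p)      = sym (atoms-sound p)
  atoms-sound (trans′ p q)  = trans (atoms-sound p) (atoms-sound q)
  atoms-sound (cong¬ p)     = atoms-sound p
  atoms-sound (cong∧ p q)   = cong₂ _⊕_ (atoms-sound p) (atoms-sound q)
  atoms-sound (cong∨ p q)   = cong₂ _⊕_ (atoms-sound p) (atoms-sound q)
  atoms-sound ax1           = refl
  atoms-sound (ax2 x y)     = refl
  atoms-sound (ax3 x)       = refl
  atoms-sound (ax4 x y z)   = ⊕-assoc (atoms x) (atoms y) (atoms z)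
  atoms-sound (ax5 x)       = []⊕atoms x
  atoms-sound (ax6 x)       = refl
  atoms-sound (ax7 x)       = sym ([]⊕atoms x)
  atoms-sound (ax8 x)       = refl
  atoms-sound (ax9 x y)     = refl
  atoms-sound (ax10 x y)    = refl
  atoms-sound (ax11 x y z)  =
    trans (⊕-assoc X Y Z) (sym (⊕-absorb (X ⊕ (Y ⊕ Z)) (X ⊕ Z) X⊕Z⊆X⊕[Y⊕Z]))
    where
    X = atoms x
    Y = atoms y
    Z = atoms z
    X⊕Z⊆X⊕[Y⊕Z] : ∀ {b} → b ∈ X ⊕ Z → b ∈ X ⊕ (Y ⊕ Z)
    X⊕Z⊆X⊕[Y⊕Z] b∈ with ∈-⊕⁻ X Z b∈
    ... | inj₁ b∈X = ∈-⊕⁺ˡ X (Y ⊕ Z) b∈X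
    ... | inj₂ b∈Z = ∈-⊕⁺ʳ X (Y ⊕ Z) (∈-⊕⁺ʳ Y Z b∈Z)

  atoms-NF : ∀ {σ Q} → Unique σ → NF A σ Q → atoms Q ≡ σ
  atoms-NF _            nf-T = refl
  atoms-NF _            nf-F = refl
  atoms-NF {a ∷ ρ} (a∉ρ ∷ !ρ) (nf-a {P₁ = P} {P₂ = Q} nfP nfQ) = begin
    ([ a ] ⊕ atoms P) ⊕ ([ a ] ⊕ atoms Q)
      ≡⟨ cong₂ (λ l r → ([ a ] ⊕ l) ⊕ ([ a ] ⊕ r)) (atoms-NF !ρ nfP) (atoms-NF !ρ nfQ) ⟩
    ([ a ] ⊕ ρ) ⊕ ([ a ] ⊕ ρ)
      ≡⟨ ⊕-absorb ([ a ] ⊕ ρ) ([ a ] ⊕ ρ) id ⟩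
    [ a ] ⊕ ρ
      ≡⟨ ⊕-fresh [ a ] ρ !ρ ρ∌a ⟩
    a ∷ ρ
      ∎
    where
    open ≡-Reasoning
    ρ∌a : ∀ {b} → b ∈ ρ → b ∉ [ a ]
    ρ∌a b∈ρ (here b≡a) = All.lookup a∉ρ b∈ρ (sym b≡a)

  lit : Bool → SP A
  lit true  = T
  lit false = F

  _[_≔_] : SP A → A → Bool → SP A
  T [ a ≔ b ]        = T
  F [ a ≔ b ]        = F
  at c [ a ≔ b ] with a ≟ c
  ... | yes _ = lit b
  ... | no  _ = at c
  (¬ x) [ a ≔ b ]    = ¬ (x [ a ≔ b ])
  (x ∧• y) [ a ≔ b ] = x [ a ≔ b ] ∧• y [ a ≔ b ]
  (x ∨• y) [ a ≔ b ] = x [ a ≔ b ] ∨• y [ a ≔ b ]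

  ≈[]-[≔] : ∀ {u a b} → at a ≈[ u ] lit b → ∀ P → P ≈[ u ] P [ a ≔ b ]
  ≈[]-[≔] h T        = refl′
  ≈[]-[≔] h F        = refl′
  ≈[]-[≔] {a = a} h (at c) with a ≟ c
  ... | yes refl = h
  ... | no  _    = refl′
  ≈[]-[≔] h (¬ x)    = ≈[]-cong¬ (≈[]-[≔] h x)
  ≈[]-[≔] h (x ∧• y) = ≈[]-cong∧ (≈[]-[≔] h x) (≈[]-[≔] h y)
  ≈[]-[≔] h (x ∨• y) = ≈[]-cong∨ (≈[]-[≔] h x) (≈[]-[≔] h y)

  atoms-lit : ∀ b → atoms (lit b) ≡ []
  atoms-lit true  = refl
  atoms-lit false = refl

  atoms-[≔]-irrelevant : ∀ P a b b′ → atoms (P [ a ≔ b ]) ≡ atoms (P [ a ≔ b′ ])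
  atoms-[≔]-irrelevant T        a b b′ = refl
  atoms-[≔]-irrelevant F        a b b′ = refl
  atoms-[≔]-irrelevant (at c)   a b b′ with a ≟ c
  ... | yes _ = trans (atoms-lit b) (sym (atoms-lit b′))
  ... | no  _ = refl
  atoms-[≔]-irrelevant (¬ x)    a b b′ = atoms-[≔]-irrelevant x a b b′
  atoms-[≔]-irrelevant (x ∧• y) a b b′ =
    cong₂ _⊕_ (atoms-[≔]-irrelevant x a b b′) (atoms-[≔]-irrelevant y a b b′)
  atoms-[≔]-irrelevant (x ∨• y) a b b′ =
    cong₂ _⊕_ (atoms-[≔]-irrelevant x a b b′) (atoms-[≔]-irrelevant y a b b′)

  ∉-atoms-[≔] : ∀ P a b → a ∉ atoms (P [ a ≔ b ])
  ∉-atoms-[≔] T        a b ()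
  ∉-atoms-[≔] F        a b ()
  ∉-atoms-[≔] (at c)   a b a∈ with a ≟ c
  ∉-atoms-[≔] (at c)   a true  () | yes _
  ∉-atoms-[≔] (at c)   a false () | yes _
  ∉-atoms-[≔] (at c)   a b (here a≡c) | no a≢c = a≢c a≡c
  ∉-atoms-[≔] (¬ x)    a b a∈ = ∉-atoms-[≔] x a b a∈
  ∉-atoms-[≔] (x ∧• y) a b a∈ = Sum.[ ∉-atoms-[≔] x a b , ∉-atoms-[≔] y a b ]′ (∈-⊕⁻ _ _ a∈)
  ∉-atoms-[≔] (x ∨• y) a b a∈ = Sum.[ ∉-atoms-[≔] x a b , ∉-atoms-[≔] y a b ]′ (∈-⊕⁻ _ _ a∈)

  firstAtom : SP A → Maybe A
  firstAtom T        = nothing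
  firstAtom F        = nothing
  firstAtom (at a)   = just a
  firstAtom (¬ x)    = firstAtom x
  firstAtom (x ∧• y) = firstAtom x <∣> firstAtom y
  firstAtom (x ∨• y) = firstAtom x <∣> firstAtom y

  IsConst-firstAtom : ∀ P → firstAtom P ≡ nothing → IsConst P
  IsConst-firstAtom T        _ = inj₁ refl′
  IsConst-firstAtom F        _ = inj₂ refl′
  IsConst-firstAtom (¬ x)    e = IsConst-¬ (IsConst-firstAtom x e)
  IsConst-firstAtom (x ∧• y) e with firstAtom x in ex
  ... | nothing = IsConst-∧ (IsConst-firstAtom x ex) (IsConst-firstAtom y e)
  IsConst-firstAtom (x ∨• y) e with firstAtom x in ex
  ... | nothing = IsConst-∨ (IsConst-firstAtom x ex) (IsConst-firstAtom y e)

  Leads-firstAtom : ∀ {a} P → firstAtom P ≡ just a → Leads (at a) P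
  Leads-firstAtom (at a)   refl = Leads-refl (at a)
  Leads-firstAtom (¬ x)    e    = Leads-¬ (Leads-firstAtom x e)
  Leads-firstAtom (x ∧• y) e with firstAtom x in ex
  Leads-firstAtom (x ∧• y) refl | just _ = Leads-∧ˡ y (Leads-firstAtom x ex)
  ... | nothing = Leads-∧ʳ (IsConst-firstAtom x ex) (Leads-firstAtom y e)
  Leads-firstAtom (x ∨• y) e with firstAtom x in ex
  Leads-firstAtom (x ∨• y) refl | just _ = Leads-∨ˡ y (Leads-firstAtom x ex)
  ... | nothing = Leads-∨ʳ (IsConst-firstAtom x ex) (Leads-firstAtom y e)

  shannon : ∀ {a} P → firstAtom P ≡ just a → P ≈ P [ a ≔ true ] ◁ a ▷ P [ a ≔ false ]
  shannon {a} P e =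
    trans′ (Leads-expand (Leads-firstAtom P e))
           (cong∨ (≈[]-[≔] (x≈[x]T (at a)) P) (≈[]-[≔] (x≈[¬x]F (at a)) P))

  occurrences : SP A → ℕ
  occurrences T        = 0
  occurrences F        = 0
  occurrences (at a)   = 1
  occurrences (¬ x)    = occurrences x
  occurrences (x ∧• y) = occurrences x + occurrences y
  occurrences (x ∨• y) = occurrences x + occurrences y

  occurrences-lit : ∀ b → occurrences (lit b) ≡ 0
  occurrences-lit true  = refl
  occurrences-lit false = refl

  occurrences-[≔]-≤ : ∀ P a b → occurrences (P [ a ≔ b ]) ≤ occurrences P
  occurrences-[≔]-≤ T        a b = z≤n
  occurrences-[≔]-≤ F        a b = z≤n
  occurrences-[≔]-≤ (at c)   a b with a ≟ c
  ... | yes _ rewrite occurrences-lit b = z≤n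
  ... | no  _ = ≤-refl
  occurrences-[≔]-≤ (¬ x)    a b = occurrences-[≔]-≤ x a b
  occurrences-[≔]-≤ (x ∧• y) a b = +-mono-≤ (occurrences-[≔]-≤ x a b) (occurrences-[≔]-≤ y a b)
  occurrences-[≔]-≤ (x ∨• y) a b = +-mono-≤ (occurrences-[≔]-≤ x a b) (occurrences-[≔]-≤ y a b)

  occurrences-[≔]-< : ∀ {a} P b → firstAtom P ≡ just a → occurrences (P [ a ≔ b ]) < occurrences P
  occurrences-[≔]-< {a} (at c) b refl with a ≟ c
  ... | yes _ rewrite occurrences-lit b = s≤s z≤n
  ... | no a≢a = ⊥-elim (a≢a refl)
  occurrences-[≔]-< (¬ x)    b e = occurrences-[≔]-< x b e
  occurrences-[≔]-< (x ∧• y) b e with firstAtom x in ex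
  occurrences-[≔]-< {a} (x ∧• y) b refl | just _ =
    +-mono-<-≤ (occurrences-[≔]-< x b ex) (occurrences-[≔]-≤ y a b)
  occurrences-[≔]-< {a} (x ∧• y) b e | nothing =
    +-mono-≤-< (occurrences-[≔]-≤ x a b) (occurrences-[≔]-< y b e)
  occurrences-[≔]-< (x ∨• y) b e with firstAtom x in ex
  occurrences-[≔]-< {a} (x ∨• y) b refl | just _ =
    +-mono-<-≤ (occurrences-[≔]-< x b ex) (occurrences-[≔]-≤ y a b)
  occurrences-[≔]-< {a} (x ∨• y) b e | nothing =
    +-mono-≤-< (occurrences-[≔]-≤ x a b) (occurrences-[≔]-< y b e)

  NormalForm : SP A → Set
  NormalForm Q = Σ (List A) λ σ → As A σ × NF A σ Q

  NormalForm-◁▷ : ∀ {a Q₁ Q₂} → NormalForm Q₁ → NormalForm Q₂ →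
                  atoms Q₁ ≡ atoms Q₂ → a ∉ atoms Q₁ → NormalForm (Q₁ ◁ a ▷ Q₂)
  NormalForm-◁▷ {a} {Q₁} {Q₂} (σ₁ , !σ₁ , nf₁) (σ₂ , !σ₂ , nf₂) same a∉ =
    a ∷ σ₁ , ¬Any⇒All¬ σ₁ a∉σ₁ ∷ !σ₁ , nf-a nf₁ (subst (λ σ → NF A σ Q₂) σ₂≡σ₁ nf₂)
    where
    σ₂≡σ₁ : σ₂ ≡ σ₁
    σ₂≡σ₁ = trans (sym (atoms-NF !σ₂ nf₂)) (trans (sym same) (atoms-NF !σ₁ nf₁))
    a∉σ₁ : a ∉ σ₁
    a∉σ₁ = subst (a ∉_) (atoms-NF !σ₁ nf₁) a∉

  normalise : ∀ P → Acc _<_ (occurrences P) → Σ[ Q ∈ SP A ] NormalForm Q × P ≈ Q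
  normalise P _ with firstAtom P in e
  normalise P _ | nothing with IsConst-firstAtom P e
  ... | inj₁ P≈T = T , ([] , [] , nf-T) , P≈T
  ... | inj₂ P≈F = F , ([] , [] , nf-F) , P≈F
  normalise P (acc rec) | just a
    with normalise (P [ a ≔ true ]) (rec (occurrences-[≔]-< P true e))
       | normalise (P [ a ≔ false ]) (rec (occurrences-[≔]-< P false e))
  ... | Q₁ , nf₁ , P₁≈Q₁ | Q₂ , nf₂ , P₂≈Q₂ =
    Q₁ ◁ a ▷ Q₂ ,
    NormalForm-◁▷ nf₁ nf₂ same a∉ ,
    trans′ (shannon P e) (cong∨ (cong∧ refl′ P₁≈Q₁) (cong∧ refl′ P₂≈Q₂))
    where
    same : atoms Q₁ ≡ atoms Q₂
    same = trans (sym (atoms-sound P₁≈Q₁))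
                 (trans (atoms-[≔]-irrelevant P a true false) (atoms-sound P₂≈Q₂))
    a∉ : a ∉ atoms Q₁
    a∉ = subst (a ∉_) (atoms-sound P₁≈Q₁) (∉-atoms-[≔] P a true)

  _[_↦_] : (A → Bool) → A → Bool → A → Bool
  (v [ a ↦ b ]) c = if does (c ≟ a) then b else v c

  ↦-same : ∀ v a b → (v [ a ↦ b ]) a ≡ b
  ↦-same v a b with a ≟ a
  ... | yes _  = refl
  ... | no a≢a = ⊥-elim (a≢a refl)

  ↦-other : ∀ v a b {c} → a ≢ c → (v [ a ↦ b ]) c ≡ v c
  ↦-other v a b {c} a≢c with c ≟ a
  ... | yes c≡a = ⊥-elim (a≢c (sym c≡a))
  ... | no  _   = refl

  ⟦◁▷⟧-↦ : ∀ {a ρ P Q} → All (a ≢_) ρ → NF A ρ P → NF A ρ Q →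
           ∀ v b → ⟦ P ◁ a ▷ Q ⟧ (v [ a ↦ b ]) ≡ (if b then ⟦ P ⟧ v else ⟦ Q ⟧ v)
  ⟦◁▷⟧-↦ {a} {ρ} {P} {Q} a∉ρ nfP nfQ v b
    rewrite ⟦◁▷⟧ (v [ a ↦ b ]) P a Q | ↦-same v a b with b
  ... | true  = ⟦⟧-NF-cong nfP (All.map (↦-other v a true) a∉ρ)
  ... | false = ⟦⟧-NF-cong nfQ (All.map (↦-other v a false) a∉ρ)

  NF-injective : ∀ {σ Q Q′} → Unique σ → NF A σ Q → NF A σ Q′ →
                 (∀ v → ⟦ Q ⟧ v ≡ ⟦ Q′ ⟧ v) → Q ≡ Q′
  NF-injective _ nf-T nf-T _ = refl
  NF-injective _ nf-F nf-F _ = refl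
  NF-injective _ nf-T nf-F Q≗Q′ with () ← Q≗Q′ (λ _ → true)
  NF-injective _ nf-F nf-T Q≗Q′ with () ← Q≗Q′ (λ _ → true)
  NF-injective {a ∷ ρ} (a∉ρ ∷ !ρ) (nf-a {P₁ = P} {Q} nfP nfQ) (nf-a {P₁ = P′} {Q′} nfP′ nfQ′) Q≗Q′ =
    cong₂ (_◁ a ▷_) (NF-injective !ρ nfP nfP′ (branch true))
                    (NF-injective !ρ nfQ nfQ′ (branch false))
    where
    branch : ∀ b v → (if b then ⟦ P ⟧ v else ⟦ Q ⟧ v) ≡ (if b then ⟦ P′ ⟧ v else ⟦ Q′ ⟧ v)
    branch b v = begin
      (if b then ⟦ P ⟧ v else ⟦ Q ⟧ v)     ≡⟨ ⟦◁▷⟧-↦ a∉ρ nfP nfQ v b ⟨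
      ⟦ P ◁ a ▷ Q ⟧ (v [ a ↦ b ])          ≡⟨ Q≗Q′ (v [ a ↦ b ]) ⟩
      ⟦ P′ ◁ a ▷ Q′ ⟧ (v [ a ↦ b ])        ≡⟨ ⟦◁▷⟧-↦ a∉ρ nfP′ nfQ′ v b ⟩
      (if b then ⟦ P′ ⟧ v else ⟦ Q′ ⟧ v)   ∎
      where open ≡-Reasoning

  NormalForm-unique : ∀ {Q Q′} → NormalForm Q → NormalForm Q′ → Q ≈ Q′ → Q ≡ Q′
  NormalForm-unique {Q′ = Q′} (σ , !σ , nf) (σ′ , !σ′ , nf′) Q≈Q′ =
    NF-injective !σ nf (subst (λ s → NF A s Q′) σ′≡σ nf′) (⟦⟧-sound Q≈Q′)
    where
    σ′≡σ : σ′ ≡ σ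
    σ′≡σ = trans (sym (atoms-NF !σ′ nf′)) (trans (sym (atoms-sound Q≈Q′)) (atoms-NF !σ nf))

lemma4p17 : (A : Set) → Countable A → (P : SP A) →
    ∃! _≡_ (λ (Q : SP A) → Σ (List A) (λ σ → As A σ × NF A σ Q) × _⊢≈_ A P Q)
lemma4p17 A (f , f-injective) P =
  let Q , nfQ , P≈Q = normalise _≟_ P (<-wellFounded _)
  in  Q , (nfQ , P≈Q) ,
      λ (nfQ′ , P≈Q′) → NormalForm-unique _≟_ nfQ nfQ′ (trans′ (sym′ P≈Q) P≈Q′)
  where
  _≟_ : DecidableEquality A
  _≟_ = eq? (mk↣ f-injective)
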